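{- Let $n,\mu$ be non-negative integers with $\mu\ge 1$. The number of sequences of balls (of any finite length) colored in at most $n$ colors that contain exactly $\mu$ balls whose color appears earlier in the sequence is $$\sum_{k=\mu+1}^{n+\mu}\ \sum_{\lambda=0}^{\mu} Z(k,n,\mu+\lambda,\lambda).$$
   Context: A sequence of $k$ balls colored in at most $n$ colors is a function $c:\{1,\dots,k\}\to\{1,\dots,n\}$; sequences of different lengths are different. Ball $i$ has its color appearing earlier if there is $j<i$ with $c(j)=c(i)$. A ball $i$ matches another ball if there is $j\ne i$ with $c(j)=c(i)$; a color is repeated if it is the color of at least two balls. $Z(k,n,m,\lambda)$ denotes the number of such sequences of length $k$ in which exactly $m$ balls match some other ball and exactly $\lambda$ colors are repeated. -}

module Defs where

open import Data.Nat using (ℕ; zero; suc; _+_; _∸_; _≤_; _≤?_)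
open import Data.Fin using (Fin) renaming (_<_ to _<ᶠ_; _<?_ to _<ᶠ?_)
import Data.Fin.Properties as FinP
open import Data.Vec using (Vec; []; _∷_; lookup)
open import Data.List using (List; []; _∷_; length; filter; allFin; upTo; map; concatMap)
open import Data.Nat.ListAction using (sum)
open import Data.Product using (Σ; ∃; _×_; _,_)
open import Relation.Nullary using (¬_; _×-dec_; ¬?)
open import Relation.Binary.PropositionalEquality using (_≡_; _≢_)
open import Relation.Unary using (Pred; Decidable)

count : ∀ {k} {p} {P : Pred (Fin k) p} → Decidable P → ℕ
count {k} P? = length (filter P? (allFin k))

-- A sequence of k balls coloured in at most n colours: c : {1..k} → {1..n},
-- represented as a vector c with c(i) = lookup c i.
Seq : ℕ → ℕ → Set
Seq k n = Vec (Fin n) k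

Earlier : ∀ {k n} → Seq k n → Fin k → Set
Earlier c i = ∃ λ j → (j <ᶠ i) × (lookup c j ≡ lookup c i)

earlier? : ∀ {k n} (c : Seq k n) → Decidable (Earlier c)
earlier? c i = FinP.any? (λ j → (j <ᶠ? i) ×-dec (lookup c j FinP.≟ lookup c i))

Matches : ∀ {k n} → Seq k n → Fin k → Set
Matches c i = ∃ λ j → (j ≢ i) × (lookup c j ≡ lookup c i)

matches? : ∀ {k n} (c : Seq k n) → Decidable (Matches c)
matches? c i = FinP.any? (λ j → ¬? (j FinP.≟ i) ×-dec (lookup c j FinP.≟ lookup c i))

colourCount : ∀ {k n} → Seq k n → Fin n → ℕ
colourCount c col = count (λ i → lookup c i FinP.≟ col)

Repeated : ∀ {k n} → Seq k n → Fin n → Set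
Repeated c col = 2 ≤ colourCount c col

repeated? : ∀ {k n} (c : Seq k n) → Decidable (Repeated c)
repeated? c col = 2 ≤? colourCount c col

numEarlier : ∀ {k n} → Seq k n → ℕ
numEarlier c = count (earlier? c)

numMatching : ∀ {k n} → Seq k n → ℕ
numMatching c = count (matches? c)

numRepeated : ∀ {k n} → Seq k n → ℕ
numRepeated c = count (repeated? c)

allSeqs : ∀ k n → List (Seq k n)
allSeqs zero n = [] ∷ []
allSeqs (suc k) n = concatMap (λ x → map (x ∷_) (allSeqs k n)) (allFin n)

Z : ℕ → ℕ → ℕ → ℕ → ℕ
Z k n m l = length (filter (λ c → (numMatching c Data.Nat.≟ m) ×-dec (numRepeated c Data.Nat.≟ l)) (allSeqs k n))

-- ∑_{i=a}^{b} f i  (empty when b < a)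
sumFromTo : ℕ → ℕ → (ℕ → ℕ) → ℕ
sumFromTo a b f = sum (map (λ i → f (a + i)) (upTo (suc b ∸ a)))

module Submission where

open import Defs
open import Data.Nat using (ℕ; suc; _+_; _≤_)
open import Data.Fin using (Fin)
open import Data.Product using (Σ)
open import Relation.Binary.PropositionalEquality using (_≡_)
open import Function.Bundles using (_↔_)

open import Data.Nat using (zero; _*_; _∸_; _<_; z≤n; s≤s; s≤s⁻¹; _≤?_; _≟_)
open import Data.Nat.Properties
  using (+-*-semiring; +-identityʳ; +-suc; +-comm; +-cancelʳ-≡; +-cancelˡ-≤; +-mono-≤;
         m≤m+n; m≤n+m∸n; m+n∸n≡m; n≮0; ≡-irrelevant; module ≤-Reasoning)
open import Data.Nat.ListAction using () renaming (sum to listSum)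
open import Data.Fin using (zero; suc; toℕ; fromℕ<)
import Data.Fin.Properties as FinP
open import Data.Vec using (Vec; []; _∷_; lookup)
open import Data.List using (List; []; _∷_; _++_; length; filter; map; tabulate; applyUpTo; concatMap)
open import Data.List.Properties using (filter-++; length-++)
open import Data.Product using (∃; _×_; _,_; proj₁; proj₂)
open import Data.Sum using (_⊎_; inj₁; inj₂; [_,_]′)
open import Data.Sum.Function.Propositional using (_⊎-↔_)
open import Data.Product.Function.Dependent.Propositional using (Σ-↔)
open import Data.Unit using (⊤; tt)
open import Data.Empty using (⊥-elim)
open import Relation.Nullary using (Dec; yes; no; does; ¬_; _×-dec_; ¬?)
open import Data.Bool using (if_then_else_)
open import Relation.Unary using (Decidable)
open import Relation.Binary.PropositionalEquality using (refl; sym; trans; cong; cong₂; subst; subst₂; module ≡-Reasoning)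
open import Function using (_∘_)
open import Function.Bundles using (mk↔ₛ′)
open import Function.Properties.Inverse using (↔-refl; ↔-sym; ↔-trans)
open import Function.Related.Propositional using (module EquationalReasoning)
open import Algebra.Properties.Semiring.Sum +-*-semiring
  using (sum-syntax; sum-cong-≗; sum-replicate-zero; ∑-distrib-+; ∑-comm; *-distribˡ-sum)

-- Group the k balls of a sequence c by colour and let a be the
-- size of a colour class.  Inside the class exactly a ∸ 1 balls have their
-- colour appearing earlier (all but the first), every ball matches another
-- one iff a ≥ 2, and the colour is repeated iff a ≥ 2.  Summing over the n
-- colours, the numbers E, M, R of earlier balls, matching balls and
-- repeated colours satisfy
--     E + R = M,    R ≤ E,    k ≤ n + E,    E < k  (for k ≥ 1).
-- So a sequence with E = μ ≥ 1 has length μ < k ≤ n + μ, and it has E = μ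
-- iff (M , R) = (μ + λ , λ) for exactly one λ ≤ μ; this turns the count of
-- such sequences of length k into ∑_{λ ≤ μ} Z(k, n, μ + λ, λ).

𝟙 : {P : Set} → Dec P → ℕ
𝟙 P? = if does P? then 1 else 0

𝟙-cong : {P Q : Set} → (P → Q) → (Q → P) → (P? : Dec P) (Q? : Dec Q) → 𝟙 P? ≡ 𝟙 Q?
𝟙-cong to from (yes p) (yes q) = refl
𝟙-cong to from (yes p) (no ¬q) = ⊥-elim (¬q (to p))
𝟙-cong to from (no ¬p) (yes q) = ⊥-elim (¬p (from q))
𝟙-cong to from (no ¬p) (no ¬q) = refl

𝟙-yes : {P : Set} → P → (P? : Dec P) → 𝟙 P? ≡ 1
𝟙-yes p (yes _) = refl
𝟙-yes p (no ¬p) = ⊥-elim (¬p p)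

𝟙-no : {P : Set} → ¬ P → (P? : Dec P) → 𝟙 P? ≡ 0
𝟙-no ¬p (yes p) = ⊥-elim (¬p p)
𝟙-no ¬p (no _)  = refl

𝟙≤1 : {P : Set} (P? : Dec P) → 𝟙 P? ≤ 1
𝟙≤1 (yes _) = s≤s z≤n
𝟙≤1 (no _)  = z≤n

𝟙-× : {P Q : Set} (P? : Dec P) (Q? : Dec Q) → 𝟙 (P? ×-dec Q?) ≡ 𝟙 P? * 𝟙 Q?
𝟙-× (yes _) (yes _) = refl
𝟙-× (yes _) (no _)  = refl
𝟙-× (no _)  (yes _) = refl
𝟙-× (no _)  (no _)  = refl

𝟙-split : {D Q : Set} (D? : Dec D) (Q? : Dec Q) → 𝟙 Q? ≡ 𝟙 (D? ×-dec Q?) + 𝟙 (¬? D? ×-dec Q?)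
𝟙-split (yes _) (yes _) = refl
𝟙-split (yes _) (no _)  = refl
𝟙-split (no _)  (yes _) = refl
𝟙-split (no _)  (no _)  = refl

∑-const-1 : ∀ k → ∑[ i < k ] 1 ≡ k
∑-const-1 zero    = refl
∑-const-1 (suc k) = cong suc (∑-const-1 k)

∑-mono-≤ : ∀ {k} {f g : Fin k → ℕ} → (∀ i → f i ≤ g i) → ∑[ i < k ] f i ≤ ∑[ i < k ] g i
∑-mono-≤ {zero}  f≤g = z≤n
∑-mono-≤ {suc k} f≤g = +-mono-≤ (f≤g zero) (∑-mono-≤ (f≤g ∘ suc))

# : ∀ {k} {P : Fin k → Set} → Decidable P → ℕ
# {k} P? = ∑[ i < k ] 𝟙 (P? i)

#-cong : ∀ {k} {P Q : Fin k → Set} (P? : Decidable P) (Q? : Decidable Q) →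
  (∀ i → P i → Q i) → (∀ i → Q i → P i) → # P? ≡ # Q?
#-cong P? Q? to from = sum-cong-≗ (λ i → 𝟙-cong (to i) (from i) (P? i) (Q? i))

#≤ : ∀ {k} {P : Fin k → Set} (P? : Decidable P) → # P? ≤ k
#≤ {k} P? = subst (# P? ≤_) (∑-const-1 k) (∑-mono-≤ (λ i → 𝟙≤1 (P? i)))

#-zero : ∀ {k} {P : Fin k → Set} (P? : Decidable P) → (∀ i → ¬ P i) → # P? ≡ 0
#-zero {k} P? none = trans (sum-cong-≗ (λ i → 𝟙-no (none i) (P? i))) (sum-replicate-zero k)

#-unique : ∀ {k} {P : Fin k → Set} (P? : Decidable P) (i : Fin k) →
  (∀ j → P j → j ≡ i) → # P? ≡ 𝟙 (P? i)
#-unique {suc k} P? zero only-i =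
  trans (cong (𝟙 (P? zero) +_) (#-zero (P? ∘ suc) (λ j p → FinP.0≢1+n (sym (only-i (suc j) p)))))
        (+-identityʳ _)
#-unique {suc k} P? (suc i) only-i =
  cong₂ _+_ (𝟙-no (λ p → FinP.0≢1+n (only-i zero p)) (P? zero))
            (#-unique (P? ∘ suc) i (λ j p → FinP.suc-injective (only-i (suc j) p)))

#-split-at : ∀ {k} {Q : Fin k → Set} (Q? : Decidable Q) (i : Fin k) →
  # Q? ≡ 𝟙 (Q? i) + # (λ j → ¬? (j FinP.≟ i) ×-dec Q? j)
#-split-at {k} Q? i = begin
    # Q?
  ≡⟨ sum-cong-≗ (λ j → 𝟙-split (j FinP.≟ i) (Q? j)) ⟩
    ∑[ j < k ] (𝟙 ((j FinP.≟ i) ×-dec Q? j) + 𝟙 (¬? (j FinP.≟ i) ×-dec Q? j))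
  ≡⟨ ∑-distrib-+ (λ j → 𝟙 ((j FinP.≟ i) ×-dec Q? j)) (λ j → 𝟙 (¬? (j FinP.≟ i) ×-dec Q? j)) ⟩
    # (λ j → (j FinP.≟ i) ×-dec Q? j) + # (λ j → ¬? (j FinP.≟ i) ×-dec Q? j)
  ≡⟨ cong (_+ # (λ j → ¬? (j FinP.≟ i) ×-dec Q? j)) (#-unique (λ j → (j FinP.≟ i) ×-dec Q? j) i (λ j → proj₁)) ⟩
    𝟙 ((i FinP.≟ i) ×-dec Q? i) + # (λ j → ¬? (j FinP.≟ i) ×-dec Q? j)
  ≡⟨ cong (_+ # (λ j → ¬? (j FinP.≟ i) ×-dec Q? j)) (𝟙-cong proj₂ (refl ,_) ((i FinP.≟ i) ×-dec Q? i) (Q? i)) ⟩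
    𝟙 (Q? i) + # (λ j → ¬? (j FinP.≟ i) ×-dec Q? j)
  ∎
  where open ≡-Reasoning

#-pos : ∀ {k} {P : Fin k → Set} (P? : Decidable P) (i : Fin k) → P i → 1 ≤ # P?
#-pos P? i p = begin
    1                                                       ≡⟨ sym (𝟙-yes p (P? i)) ⟩
    𝟙 (P? i)                                                ≤⟨ m≤m+n (𝟙 (P? i)) (# (λ j → ¬? (j FinP.≟ i) ×-dec P? j)) ⟩
    𝟙 (P? i) + # (λ j → ¬? (j FinP.≟ i) ×-dec P? j)         ≡⟨ sym (#-split-at P? i) ⟩
    # P?                                                    ∎
  where open ≤-Reasoning

#-pos⁻¹ : ∀ {k} {P : Fin k → Set} (P? : Decidable P) → 1 ≤ # P? → ∃ P
#-pos⁻¹ {suc k} P? pos with P? zero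
... | yes p = zero , p
... | no _  = let (j , p) = #-pos⁻¹ (P? ∘ suc) pos in suc j , p

#-fibres : ∀ {k n} {P : Fin k → Set} (P? : Decidable P) (f : Fin k → Fin n) →
  # P? ≡ ∑[ y < n ] # (λ i → P? i ×-dec (f i FinP.≟ y))
#-fibres {k} {n} P? f = trans (sum-cong-≗ in-one-fibre) (∑-comm (λ i y → 𝟙 (P? i ×-dec (f i FinP.≟ y))))
  where
  in-one-fibre : ∀ i → 𝟙 (P? i) ≡ ∑[ y < n ] 𝟙 (P? i ×-dec (f i FinP.≟ y))
  in-one-fibre i = sym (trans (#-unique (λ y → P? i ×-dec (f i FinP.≟ y)) (f i) (λ y → sym ∘ proj₂))
                              (𝟙-cong proj₁ (_, refl) (P? i ×-dec (f i FinP.≟ f i)) (P? i)))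

length-filter-∷ : ∀ {A : Set} {P : A → Set} (P? : Decidable P) x xs →
  length (filter P? (x ∷ xs)) ≡ 𝟙 (P? x) + length (filter P? xs)
length-filter-∷ P? x xs with P? x
... | yes _ = refl
... | no _  = refl

length-filter-map : ∀ {A B : Set} (g : A → B) {P : B → Set} (P? : Decidable P) xs →
  length (filter P? (map g xs)) ≡ length (filter (P? ∘ g) xs)
length-filter-map g P? []       = refl
length-filter-map g P? (x ∷ xs) = trans (length-filter-∷ P? (g x) (map g xs))
  (trans (cong (𝟙 (P? (g x)) +_) (length-filter-map g P? xs)) (sym (length-filter-∷ (P? ∘ g) x xs)))

length-filter-tabulate : ∀ {A : Set} {k} (f : Fin k → A) {P : A → Set} (P? : Decidable P) →
  length (filter P? (tabulate f)) ≡ ∑[ i < k ] 𝟙 (P? (f i))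
length-filter-tabulate {k = zero}  f P? = refl
length-filter-tabulate {k = suc k} f P? = trans (length-filter-∷ P? (f zero) (tabulate (f ∘ suc)))
  (cong (𝟙 (P? (f zero)) +_) (length-filter-tabulate (f ∘ suc) P?))

length-filter-concatMap : ∀ {A B : Set} {k} (h : A → List B) (f : Fin k → A) {P : B → Set} (P? : Decidable P) →
  length (filter P? (concatMap h (tabulate f))) ≡ ∑[ i < k ] length (filter P? (h (f i)))
length-filter-concatMap {k = zero}  h f P? = refl
length-filter-concatMap {B = B} {k = suc k} h f P? = begin
    length (filter P? (h (f zero) ++ rest))
  ≡⟨ cong length (filter-++ P? (h (f zero)) rest) ⟩
    length (filter P? (h (f zero)) ++ filter P? rest)
  ≡⟨ length-++ (filter P? (h (f zero))) ⟩
    length (filter P? (h (f zero))) + length (filter P? rest)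
  ≡⟨ cong (length (filter P? (h (f zero))) +_) (length-filter-concatMap h (f ∘ suc) P?) ⟩
    ∑[ i < suc k ] length (filter P? (h (f i)))
  ∎
  where
  open ≡-Reasoning
  rest : List B
  rest = concatMap h (tabulate (f ∘ suc))

count≡# : ∀ {k} {P : Fin k → Set} (P? : Decidable P) → count P? ≡ # P?
count≡# P? = length-filter-tabulate (λ i → i) P?

length-filter-∑ : ∀ {A : Set} {m} {P : A → Set} (P? : Decidable P) {Q : Fin m → A → Set}
  (Q? : ∀ l → Decidable (Q l)) → (∀ x → 𝟙 (P? x) ≡ ∑[ l < m ] 𝟙 (Q? l x)) →
  ∀ xs → length (filter P? xs) ≡ ∑[ l < m ] length (filter (Q? l) xs)
length-filter-∑ {m = m} P? Q? split [] = sym (sum-replicate-zero m)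
length-filter-∑ {m = m} P? Q? split (x ∷ xs) = begin
    length (filter P? (x ∷ xs))
  ≡⟨ length-filter-∷ P? x xs ⟩
    𝟙 (P? x) + length (filter P? xs)
  ≡⟨ cong₂ _+_ (split x) (length-filter-∑ P? Q? split xs) ⟩
    ∑[ l < m ] 𝟙 (Q? l x) + ∑[ l < m ] length (filter (Q? l) xs)
  ≡⟨ sym (∑-distrib-+ (λ l → 𝟙 (Q? l x)) (λ l → length (filter (Q? l) xs))) ⟩
    ∑[ l < m ] (𝟙 (Q? l x) + length (filter (Q? l) xs))
  ≡⟨ sum-cong-≗ (λ l → sym (length-filter-∷ (Q? l) x xs)) ⟩
    ∑[ l < m ] length (filter (Q? l) (x ∷ xs))
  ∎
  where open ≡-Reasoning

length-filter-allSeqs : ∀ {k n} {P : Seq (suc k) n → Set} (P? : Decidable P) →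
  length (filter P? (allSeqs (suc k) n)) ≡ ∑[ x < n ] length (filter (P? ∘ (x ∷_)) (allSeqs k n))
length-filter-allSeqs {k} {n} P? =
  trans (length-filter-concatMap (λ x → map (x ∷_) (allSeqs k n)) (λ x → x) P?)
        (sum-cong-≗ (λ x → length-filter-map (x ∷_) P? (allSeqs k n)))

listSum-applyUpTo : ∀ (f g : ℕ → ℕ) m → listSum (map f (applyUpTo g m)) ≡ ∑[ i < m ] f (g (toℕ i))
listSum-applyUpTo f g zero    = refl
listSum-applyUpTo f g (suc m) = cong (f (g 0) +_) (listSum-applyUpTo f (g ∘ suc) m)

sumFromTo≡∑ : ∀ a b (F : ℕ → ℕ) → sumFromTo a b F ≡ ∑[ i < suc b ∸ a ] F (a + toℕ i)
sumFromTo≡∑ a b F = listSum-applyUpTo (λ i → F (a + i)) (λ i → i) (suc b ∸ a)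

sumFromTo-suc : ∀ a m (F : ℕ → ℕ) → sumFromTo (suc a) (m + a) F ≡ ∑[ i < m ] F (suc a + toℕ i)
sumFromTo-suc a m F = trans (sumFromTo≡∑ (suc a) (m + a) F)
  (cong (λ r → ∑[ i < r ] F (suc a + toℕ i)) (m+n∸n≡m m a))

module _ {n : ℕ} where

  ofColour : ∀ {k} (c : Seq k n) (col : Fin n) → Decidable (λ i → lookup c i ≡ col)
  ofColour c col i = lookup c i FinP.≟ col

  colourCount≡# : ∀ {k} (c : Seq k n) col → colourCount c col ≡ # (ofColour c col)
  colourCount≡# c col = count≡# (ofColour c col)

  earlier-first : ∀ {k} {x : Fin n} {c : Seq k n} → ¬ Earlier (x ∷ c) zero
  earlier-first (_ , () , _)

  earlier-suc⁻ : ∀ {k} {x : Fin n} {c : Seq k n} {i} → Earlier (x ∷ c) (suc i) → x ≡ lookup c i ⊎ Earlier c i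
  earlier-suc⁻ (zero , _ , eq)      = inj₁ eq
  earlier-suc⁻ (suc j , s≤s j<i , eq) = inj₂ (j , j<i , eq)

  earlier-first-ball : ∀ {k} {x : Fin n} {c : Seq k n} {i} → x ≡ lookup c i → Earlier (x ∷ c) (suc i)
  earlier-first-ball eq = zero , s≤s z≤n , eq

  earlier-later-ball : ∀ {k} {x : Fin n} {c : Seq k n} {i} → Earlier c i → Earlier (x ∷ c) (suc i)
  earlier-later-ball (j , j<i , eq) = suc j , s≤s j<i , eq

  -- In each colour class every ball except the first has its colour appearing earlier.
  earlier-in-class : ∀ {k} (c : Seq k n) col →
    # (λ i → earlier? c i ×-dec ofColour c col i) ≡ # (ofColour c col) ∸ 1
  earlier-in-class []      col = refl
  earlier-in-class (x ∷ c) col = begin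
      𝟙 (earlier? (x ∷ c) zero ×-dec (x FinP.≟ col)) + # later
    ≡⟨ cong (_+ # later) (𝟙-no (earlier-first ∘ proj₁) (earlier? (x ∷ c) zero ×-dec (x FinP.≟ col))) ⟩
      # later
    ≡⟨ later-count (x FinP.≟ col) ⟩
      (𝟙 (x FinP.≟ col) + # (ofColour c col)) ∸ 1
    ∎
    where
    open ≡-Reasoning
    later : Decidable (λ i → Earlier (x ∷ c) (suc i) × lookup c i ≡ col)
    later = λ i → earlier? (x ∷ c) (suc i) ×-dec ofColour c col i
    later-count : (x≟col : Dec (x ≡ col)) → # later ≡ (𝟙 x≟col + # (ofColour c col)) ∸ 1
    later-count (yes x≡col) = #-cong later (ofColour c col) (λ _ → proj₂)
      (λ _ e → earlier-first-ball (trans x≡col (sym e)) , e)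
    later-count (no x≢col) = trans (#-cong later (λ i → earlier? c i ×-dec ofColour c col i)
      (λ _ → λ { (ea , e) → [ (λ x≡ → ⊥-elim (x≢col (trans x≡ e))) , (_, e) ]′ (earlier-suc⁻ ea) })
      (λ _ → λ { (ea , e) → earlier-later-ball ea , e }))
      (earlier-in-class c col)

  module _ {k} (c : Seq k n) (i : Fin k) where
    private
      others : Decidable (λ j → ¬ j ≡ i × lookup c j ≡ lookup c i)
      others = λ j → ¬? (j FinP.≟ i) ×-dec ofColour c (lookup c i) j

      class-size : colourCount c (lookup c i) ≡ suc (# others)
      class-size = trans (colourCount≡# c (lookup c i))
        (trans (#-split-at (ofColour c (lookup c i)) i) (cong (_+ # others) (𝟙-yes refl (ofColour c _ i))))

    matches→repeated : Matches c i → Repeated c (lookup c i)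
    matches→repeated (j , j≢i , eq) = subst (2 ≤_) (sym class-size) (s≤s (#-pos others j (j≢i , eq)))

    repeated→matches : Repeated c (lookup c i) → Matches c i
    repeated→matches rep = let (j , j≢i , eq) = #-pos⁻¹ others (s≤s⁻¹ (subst (2 ≤_) class-size rep))
                           in j , j≢i , eq

  matching-in-class : ∀ {k} (c : Seq k n) col →
    # (λ i → matches? c i ×-dec ofColour c col i) ≡ 𝟙 (repeated? c col) * colourCount c col
  matching-in-class {k} c col = begin
      # (λ i → matches? c i ×-dec ofColour c col i)
    ≡⟨ #-cong (λ i → matches? c i ×-dec ofColour c col i) (λ i → repeated? c col ×-dec ofColour c col i)
         (λ i → λ { (m , e) → subst (Repeated c) e (matches→repeated c i m) , e })
         (λ i → λ { (r , e) → repeated→matches c i (subst (Repeated c) (sym e) r) , e }) ⟩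
      ∑[ i < k ] 𝟙 (repeated? c col ×-dec ofColour c col i)
    ≡⟨ sum-cong-≗ (λ i → 𝟙-× (repeated? c col) (ofColour c col i)) ⟩
      ∑[ i < k ] (𝟙 (repeated? c col) * 𝟙 (ofColour c col i))
    ≡⟨ sym (*-distribˡ-sum (𝟙 (repeated? c col)) (λ i → 𝟙 (ofColour c col i))) ⟩
      𝟙 (repeated? c col) * # (ofColour c col)
    ≡⟨ cong (𝟙 (repeated? c col) *_) (sym (colourCount≡# c col)) ⟩
      𝟙 (repeated? c col) * colourCount c col
    ∎
    where open ≡-Reasoning

  length-by-colour : ∀ {k} (c : Seq k n) → k ≡ ∑[ col < n ] colourCount c col
  length-by-colour {k} c = begin
      k                                                      ≡⟨ sym (∑-const-1 k) ⟩
      # {k} {λ _ → ⊤} (λ _ → yes tt)                       ≡⟨ #-fibres (λ _ → yes tt) (lookup c) ⟩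
      ∑[ col < n ] # (λ i → yes tt ×-dec ofColour c col i)   ≡⟨ sum-cong-≗ (λ col → #-cong (λ i → yes tt ×-dec ofColour c col i) (ofColour c col) (λ _ → proj₂) (λ _ → tt ,_)) ⟩
      ∑[ col < n ] # (ofColour c col)                         ≡⟨ sum-cong-≗ (λ col → sym (colourCount≡# c col)) ⟩
      ∑[ col < n ] colourCount c col                          ∎
    where open ≡-Reasoning

  earlier-by-colour : ∀ {k} (c : Seq k n) → numEarlier c ≡ ∑[ col < n ] (colourCount c col ∸ 1)
  earlier-by-colour c = begin
      numEarlier c                                                 ≡⟨ count≡# (earlier? c) ⟩
      # (earlier? c)                                               ≡⟨ #-fibres (earlier? c) (lookup c) ⟩
      ∑[ col < n ] # (λ i → earlier? c i ×-dec ofColour c col i)   ≡⟨ sum-cong-≗ (earlier-in-class c) ⟩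
      ∑[ col < n ] (# (ofColour c col) ∸ 1)                        ≡⟨ sum-cong-≗ (λ col → cong (_∸ 1) (sym (colourCount≡# c col))) ⟩
      ∑[ col < n ] (colourCount c col ∸ 1)                         ∎
    where open ≡-Reasoning

  matching-by-colour : ∀ {k} (c : Seq k n) →
    numMatching c ≡ ∑[ col < n ] (𝟙 (repeated? c col) * colourCount c col)
  matching-by-colour c = trans (count≡# (matches? c))
    (trans (#-fibres (matches? c) (lookup c)) (sum-cong-≗ (matching-in-class c)))

  repeated-by-colour : ∀ {k} (c : Seq k n) → numRepeated c ≡ ∑[ col < n ] 𝟙 (repeated? c col)
  repeated-by-colour c = count≡# (repeated? c)

class-identity : ∀ a → (a ∸ 1) + 𝟙 (2 ≤? a) ≡ 𝟙 (2 ≤? a) * a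
class-identity zero                = refl
class-identity (suc zero)          = refl
class-identity (suc (suc b)) = trans (+-comm (suc b) 1) (sym (+-identityʳ (suc (suc b))))

class-repeated≤earlier : ∀ a → 𝟙 (2 ≤? a) ≤ a ∸ 1
class-repeated≤earlier zero          = z≤n
class-repeated≤earlier (suc zero)    = z≤n
class-repeated≤earlier (suc (suc b)) = s≤s z≤n

module _ {n : ℕ} where

  earlier+repeated≡matching : ∀ {k} (c : Seq k n) → numEarlier c + numRepeated c ≡ numMatching c
  earlier+repeated≡matching c = begin
      numEarlier c + numRepeated c
    ≡⟨ cong₂ _+_ (earlier-by-colour c) (repeated-by-colour c) ⟩
      ∑[ col < n ] (colourCount c col ∸ 1) + ∑[ col < n ] 𝟙 (repeated? c col)
    ≡⟨ sym (∑-distrib-+ (λ col → colourCount c col ∸ 1) (λ col → 𝟙 (repeated? c col))) ⟩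
      ∑[ col < n ] ((colourCount c col ∸ 1) + 𝟙 (repeated? c col))
    ≡⟨ sum-cong-≗ (λ col → class-identity (colourCount c col)) ⟩
      ∑[ col < n ] (𝟙 (repeated? c col) * colourCount c col)
    ≡⟨ sym (matching-by-colour c) ⟩
      numMatching c
    ∎
    where open ≡-Reasoning

  repeated≤earlier : ∀ {k} (c : Seq k n) → numRepeated c ≤ numEarlier c
  repeated≤earlier c = begin
      numRepeated c                          ≡⟨ repeated-by-colour c ⟩
      ∑[ col < n ] 𝟙 (repeated? c col)       ≤⟨ ∑-mono-≤ (λ col → class-repeated≤earlier (colourCount c col)) ⟩
      ∑[ col < n ] (colourCount c col ∸ 1)   ≡⟨ sym (earlier-by-colour c) ⟩
      numEarlier c                           ∎
    where open ≤-Reasoning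

  -- k ≤ n + E: each colour class has at most one ball that is not earlier.
  length≤colours+earlier : ∀ {k} (c : Seq k n) → k ≤ n + numEarlier c
  length≤colours+earlier {k} c = begin
      k                                                   ≡⟨ length-by-colour c ⟩
      ∑[ col < n ] colourCount c col                      ≤⟨ ∑-mono-≤ (λ col → m≤n+m∸n (colourCount c col) 1) ⟩
      ∑[ col < n ] (1 + (colourCount c col ∸ 1))          ≡⟨ ∑-distrib-+ (λ _ → 1) (λ col → colourCount c col ∸ 1) ⟩
      ∑[ col < n ] 1 + ∑[ col < n ] (colourCount c col ∸ 1) ≡⟨ cong₂ _+_ (∑-const-1 n) (sym (earlier-by-colour c)) ⟩
      n + numEarlier c                                    ∎
    where open ≤-Reasoning

  -- E < k for k ≥ 1: the first ball is never earlier.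
  earlier<length : ∀ {k} (x : Fin n) (c : Seq k n) → numEarlier (x ∷ c) ≤ k
  earlier<length {k} x c = begin
      numEarlier (x ∷ c)                                        ≡⟨ count≡# (earlier? (x ∷ c)) ⟩
      𝟙 (earlier? (x ∷ c) zero) + # (earlier? (x ∷ c) ∘ suc)    ≡⟨ cong (_+ # (earlier? (x ∷ c) ∘ suc)) (𝟙-no earlier-first (earlier? (x ∷ c) zero)) ⟩
      # (earlier? (x ∷ c) ∘ suc)                                ≤⟨ #≤ (earlier? (x ∷ c) ∘ suc) ⟩
      k                                                         ∎
    where open ≤-Reasoning

module _ {n : ℕ} (μ : ℕ) where

  WithEarlier : ℕ → Set
  WithEarlier k = Σ (Seq k n) λ c → numEarlier c ≡ μ

  longer-than : 1 ≤ μ → ∀ k → WithEarlier k → suc μ ≤ k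
  longer-than 1≤μ zero    ([] , E≡μ)    = ⊥-elim (n≮0 (subst (0 <_) (sym E≡μ) 1≤μ))
  longer-than 1≤μ (suc k) (x ∷ c , E≡μ) = s≤s (subst (_≤ k) E≡μ (earlier<length x c))

  at-most : ∀ k → WithEarlier k → k ≤ n + μ
  at-most k (c , E≡μ) = subst (λ e → k ≤ n + e) E≡μ (length≤colours+earlier c)

  MR? : ∀ {k} (m l : ℕ) → Decidable (λ (c : Seq k n) → numMatching c ≡ m × numRepeated c ≡ l)
  MR? m l c = (numMatching c ≟ m) ×-dec (numRepeated c ≟ l)

  𝟙-earlier≡∑-MR : ∀ {k} (c : Seq k n) →
    𝟙 (numEarlier c ≟ μ) ≡ ∑[ l < suc μ ] 𝟙 (MR? (μ + toℕ l) (toℕ l) c)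
  𝟙-earlier≡∑-MR c = by-cases (numEarlier c ≟ μ)
    where
    ∑-MR : ℕ
    ∑-MR = ∑[ l < suc μ ] 𝟙 (MR? (μ + toℕ l) (toℕ l) c)
    by-cases : (E? : Dec (numEarlier c ≡ μ)) → 𝟙 E? ≡ ∑-MR
    by-cases (no E≢μ) = sym (#-zero {suc μ} (λ l → MR? (μ + toℕ l) (toℕ l) c)
      (λ l → λ { (M≡ , R≡) → E≢μ (+-cancelʳ-≡ (toℕ l) (numEarlier c) μ
                   (trans (cong (numEarlier c +_) (sym R≡)) (trans (earlier+repeated≡matching c) M≡))) }))
    by-cases (yes E≡μ) = sym (trans (#-unique {suc μ} (λ l → MR? (μ + toℕ l) (toℕ l) c) λ₀ unique)
                                    (𝟙-yes (M≡ , R≡) (MR? (μ + toℕ λ₀) (toℕ λ₀) c)))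
      where
      R≤μ : numRepeated c ≤ μ
      R≤μ = subst (numRepeated c ≤_) E≡μ (repeated≤earlier c)
      λ₀ : Fin (suc μ)
      λ₀ = fromℕ< (s≤s R≤μ)
      R≡ : numRepeated c ≡ toℕ λ₀
      R≡ = sym (FinP.toℕ-fromℕ< (s≤s R≤μ))
      M≡ : numMatching c ≡ μ + toℕ λ₀
      M≡ = trans (sym (earlier+repeated≡matching c)) (cong₂ _+_ E≡μ R≡)
      unique : ∀ l → numMatching c ≡ μ + toℕ l × numRepeated c ≡ toℕ l → l ≡ λ₀
      unique l (_ , R≡l) = FinP.toℕ-injective (trans (sym R≡l) R≡)

  count-with-earlier : ∀ k →
    length (filter (λ c → numEarlier c ≟ μ) (allSeqs k n)) ≡ sumFromTo 0 μ (λ l → Z k n (μ + l) l)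
  count-with-earlier k = trans
    (length-filter-∑ {m = suc μ} (λ c → numEarlier c ≟ μ) (λ l → MR? (μ + toℕ l) (toℕ l)) 𝟙-earlier≡∑-MR (allSeqs k n))
    (sym (sumFromTo≡∑ 0 μ (λ l → Z k n (μ + l) l)))

↔-empty : {A B : Set} → ¬ A → ¬ B → A ↔ B
↔-empty ¬a ¬b = mk↔ₛ′ (⊥-elim ∘ ¬a) (⊥-elim ∘ ¬b) (⊥-elim ∘ ¬b) (⊥-elim ∘ ¬a)

prop↔Fin𝟙 : {P : Set} (P? : Dec P) → (∀ (p q : P) → p ≡ q) → P ↔ Fin (𝟙 P?)
prop↔Fin𝟙 (yes p) irr = mk↔ₛ′ (λ _ → zero) (λ _ → p) (λ { zero → refl }) (irr p)
prop↔Fin𝟙 (no ¬p) irr = ↔-empty ¬p (λ ())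

Σ-↔₂ : {A : Set} {B C : A → Set} → (∀ a → B a ↔ C a) → Σ A B ↔ Σ A C
Σ-↔₂ B↔C = Σ-↔ ↔-refl (λ {a} → B↔C a)

Σ-Fin-suc : ∀ {m} (B : Fin (suc m) → Set) → Σ (Fin (suc m)) B ↔ (B zero ⊎ Σ (Fin m) (B ∘ suc))
Σ-Fin-suc B = mk↔ₛ′ (λ { (zero , b) → inj₁ b ; (suc i , b) → inj₂ (i , b) })
                    (λ { (inj₁ b) → zero , b ; (inj₂ (i , b)) → suc i , b })
                    (λ { (inj₁ _) → refl ; (inj₂ _) → refl })
                    (λ { (zero , _) → refl ; (suc _ , _) → refl })

Σ-ℕ-suc : (B : ℕ → Set) → Σ ℕ B ↔ (B 0 ⊎ Σ ℕ (B ∘ suc))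
Σ-ℕ-suc B = mk↔ₛ′ (λ { (zero , b) → inj₁ b ; (suc k , b) → inj₂ (k , b) })
                  (λ { (inj₁ b) → zero , b ; (inj₂ (k , b)) → suc k , b })
                  (λ { (inj₁ _) → refl ; (inj₂ _) → refl })
                  (λ { (zero , _) → refl ; (suc _ , _) → refl })

Σ-Vec-[] : {A : Set} (P : Vec A 0 → Set) → Σ (Vec A 0) P ↔ P []
Σ-Vec-[] P = mk↔ₛ′ (λ { ([] , p) → p }) ([] ,_) (λ _ → refl) (λ { ([] , _) → refl })

Σ-Vec-∷ : {A : Set} {k : ℕ} (P : Vec A (suc k) → Set) →
  Σ (Vec A (suc k)) P ↔ Σ A (λ x → Σ (Vec A k) (P ∘ (x ∷_)))
Σ-Vec-∷ P = mk↔ₛ′ (λ { (x ∷ c , p) → x , c , p }) (λ { (x , c , p) → x ∷ c , p })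
                  (λ _ → refl) (λ { (_ ∷ _ , _) → refl })

Σ-Fin↔Fin-∑ : ∀ m (f : Fin m → ℕ) → Σ (Fin m) (Fin ∘ f) ↔ Fin (∑[ i < m ] f i)
Σ-Fin↔Fin-∑ zero    f = ↔-empty (λ { (() , _) }) (λ ())
Σ-Fin↔Fin-∑ (suc m) f = begin
    Σ (Fin (suc m)) (Fin ∘ f)                   ↔⟨ Σ-Fin-suc (Fin ∘ f) ⟩
    (Fin (f zero) ⊎ Σ (Fin m) (Fin ∘ f ∘ suc))  ↔⟨ ↔-refl ⊎-↔ Σ-Fin↔Fin-∑ m (f ∘ suc) ⟩
    (Fin (f zero) ⊎ Fin (∑[ i < m ] f (suc i))) ↔⟨ ↔-sym FinP.+↔⊎ ⟩
    Fin (∑[ i < suc m ] f i)                    ∎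
  where open EquationalReasoning

Σ-ℕ-window : ∀ m (B : ℕ → Set) → (∀ k → B k → k < m) → Σ ℕ B ↔ Σ (Fin m) (B ∘ toℕ)
Σ-ℕ-window zero    B bound = ↔-empty (λ { (k , b) → n≮0 (bound k b) }) (λ { (() , _) })
Σ-ℕ-window (suc m) B bound = begin
    Σ ℕ B                               ↔⟨ Σ-ℕ-suc B ⟩
    (B 0 ⊎ Σ ℕ (B ∘ suc))               ↔⟨ ↔-refl ⊎-↔ Σ-ℕ-window m (B ∘ suc) (λ k b → s≤s⁻¹ (bound (suc k) b)) ⟩
    (B 0 ⊎ Σ (Fin m) (B ∘ suc ∘ toℕ))   ↔⟨ ↔-sym (Σ-Fin-suc (B ∘ toℕ)) ⟩
    Σ (Fin (suc m)) (B ∘ toℕ)           ∎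
  where open EquationalReasoning

Σ-ℕ-shift : ∀ a (B : ℕ → Set) → (∀ k → B k → a ≤ k) → Σ ℕ B ↔ Σ ℕ (λ j → B (a + j))
Σ-ℕ-shift zero    B bound = ↔-refl
Σ-ℕ-shift (suc a) B bound =
  ↔-trans drop-zero (Σ-ℕ-shift a (B ∘ suc) (λ k b → s≤s⁻¹ (bound (suc k) b)))
  where
  ¬B0 : ¬ B 0
  ¬B0 b = n≮0 (bound 0 b)
  drop-zero : Σ ℕ B ↔ Σ ℕ (B ∘ suc)
  drop-zero = mk↔ₛ′ (λ { (zero , b) → ⊥-elim (¬B0 b) ; (suc k , b) → k , b })
                    (λ { (k , b) → suc k , b })
                    (λ _ → refl)
                    (λ { (zero , b) → ⊥-elim (¬B0 b) ; (suc _ , _) → refl })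

enumerate : ∀ k {n} {P : Seq k n → Set} (P? : Decidable P) → (∀ {c} (p q : P c) → p ≡ q) →
  Σ (Seq k n) P ↔ Fin (length (filter P? (allSeqs k n)))
enumerate zero {n} {P} P? irr = begin
    Σ (Seq 0 n) P                          ↔⟨ Σ-Vec-[] P ⟩
    P []                                   ↔⟨ prop↔Fin𝟙 (P? []) irr ⟩
    Fin (𝟙 (P? []))                        ≡⟨ cong Fin (sym (trans (length-filter-∷ P? [] []) (+-identityʳ _))) ⟩
    Fin (length (filter P? (allSeqs 0 n))) ∎
  where open EquationalReasoning
enumerate (suc k) {n} {P} P? irr = begin
    Σ (Seq (suc k) n) P
  ↔⟨ Σ-Vec-∷ P ⟩
    Σ (Fin n) (λ x → Σ (Seq k n) (P ∘ (x ∷_)))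
  ↔⟨ Σ-↔₂ (λ x → enumerate k (P? ∘ (x ∷_)) irr) ⟩
    Σ (Fin n) (λ x → Fin (length (filter (P? ∘ (x ∷_)) (allSeqs k n))))
  ↔⟨ Σ-Fin↔Fin-∑ n _ ⟩
    Fin (∑[ x < n ] length (filter (P? ∘ (x ∷_)) (allSeqs k n)))
  ≡⟨ cong Fin (sym (length-filter-allSeqs P?)) ⟩
    Fin (length (filter P? (allSeqs (suc k) n)))
  ∎
  where open EquationalReasoning

withEarlier↔Fin : ∀ {n} μ k → WithEarlier {n} μ k ↔ Fin (sumFromTo 0 μ λ l → Z k n (μ + l) l)
withEarlier↔Fin {n} μ k = begin
    WithEarlier μ k                                           ↔⟨ enumerate k (λ c → numEarlier c ≟ μ) ≡-irrelevant ⟩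
    Fin (length (filter (λ c → numEarlier c ≟ μ) (allSeqs k n))) ≡⟨ cong Fin (count-with-earlier μ k) ⟩
    Fin (sumFromTo 0 μ λ l → Z k n (μ + l) l)                ∎
  where open EquationalReasoning

window-bound : ∀ n μ j → suc μ + j ≤ n + μ → j < n
window-bound n μ j le = +-cancelˡ-≤ μ (suc j) n (subst₂ _≤_ (sym (+-suc μ j)) (+-comm n μ) le)

mainTheorem5 : (n μ : ℕ) → 1 ≤ μ →
    (Σ ℕ λ k → Σ (Seq k n) λ c → numEarlier c ≡ μ)
      ↔ Fin (sumFromTo (suc μ) (n + μ) λ k → sumFromTo 0 μ λ l → Z k n (μ + l) l)
mainTheorem5 n μ 1≤μ = begin
    Σ ℕ E                                      ↔⟨ Σ-ℕ-shift (suc μ) E (longer-than μ 1≤μ) ⟩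
    Σ ℕ (λ j → E (suc μ + j))                  ↔⟨ Σ-ℕ-window n _ (λ j w → window-bound n μ j (at-most μ _ w)) ⟩
    Σ (Fin n) (λ i → E (suc μ + toℕ i))        ↔⟨ Σ-↔₂ (λ i → withEarlier↔Fin μ (suc μ + toℕ i)) ⟩
    Σ (Fin n) (λ i → Fin (F (suc μ + toℕ i)))  ↔⟨ Σ-Fin↔Fin-∑ n _ ⟩
    Fin (∑[ i < n ] F (suc μ + toℕ i))         ≡⟨ cong Fin (sym (sumFromTo-suc μ n F)) ⟩
    Fin (sumFromTo (suc μ) (n + μ) F)          ∎
  where
  open EquationalReasoning
  E : ℕ → Set
  E = WithEarlier {n} μ
  F : ℕ → ℕ
  F k = sumFromTo 0 μ λ l → Z k n (μ + l) l
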